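{- If $\langle\varphi(x,y),\langle a_\eta\rangle_{\eta\in{}^{\omega>}2}\rangle$ is an antichain tree (in a monster model of a complete theory $T$), then $\varphi(x,y)$ witnesses $\mathrm{TP}_2$.
   Context: In ${}^{\omega>}2$, $\unlhd$ is the initial-segment order; $X\subseteq{}^{\omega>}2$ is an antichain if its elements are pairwise $\unlhd$-incomparable. $\langle\varphi(x,y),\langle a_\eta\rangle_{\eta\in{}^{\omega>}2}\rangle$ is an antichain tree if for all $X\subseteq{}^{\omega>}2$, $\{\varphi(x,a_\eta):\eta\in X\}$ is consistent if and only if $X$ is an antichain. $\varphi(x,y)$ has (witnesses) $\mathrm{TP}_2$ if there is an array $\langle b_{i,j}\rangle_{i,j<\omega}$ such that $\{\varphi(x,b_{i,j}):j<\omega\}$ is 2-inconsistent for each $i<\omega$ and $\{\varphi(x,b_{i,f(i)}):i<\omega\}$ is consistent for every $f:\omega\to\omega$. -}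

module Defs where

open import Data.Bool using (Bool)
open import Data.List using (List; _++_)
open import Data.List.Relation.Unary.All using (All)
open import Data.Nat using (ℕ)
open import Data.Unit using (⊤)
open import Data.Product using (Σ; ∃; _×_)
open import Relation.Binary.PropositionalEquality using (_≡_; _≢_)
open import Relation.Nullary using (¬_)

Tree : Set
Tree = List Bool

_⊴_ : Tree → Tree → Set
η ⊴ ν = ∃ λ ρ → η ++ ρ ≡ ν

IsAntichain : (Tree → Set) → Set
IsAntichain X = ∀ η ν → X η → X ν → η ⊴ ν → η ≡ ν

-- The monster model is abstracted: A = sort of the x-tuple, B = sort of the
-- y-tuple (both as sets of tuples from the monster model), and φ ⊆ A × B is
-- the relation defined by the formula φ(x,y).
-- A set {φ(x, b i) : i ∈ S} of instances with parameters from the monster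
-- model is consistent iff it is finitely satisfiable in the monster model.
Consistent : {A B : Set} (φ : A → B → Set) {I : Set} → (I → Set) → (I → B) → Set
Consistent {A} φ {I} S b =
  (l : List I) → All S l → Σ A λ x → All (λ i → φ x (b i)) l

TwoInconsistent : {A B : Set} (φ : A → B → Set) → (ℕ → B) → Set
TwoInconsistent {A} φ c = ∀ j j′ → j ≢ j′ → ¬ (Σ A λ x → φ x (c j) × φ x (c j′))

Everything : {I : Set} → I → Set
Everything _ = ⊤

HasTP2 : {A B : Set} (φ : A → B → Set) → Set
HasTP2 {A} {B} φ =
  Σ (ℕ → ℕ → B) λ b →
    (∀ i → TwoInconsistent φ (b i))
    × (∀ (f : ℕ → ℕ) → Consistent φ (Everything {ℕ}) (λ i → b i (f i)))

IsAntichainTree : {A B : Set} (φ : A → B → Set) → (Tree → B) → Set₁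
IsAntichainTree φ a =
  ∀ (X : Tree → Set) → (Consistent φ X a → IsAntichain X) × (IsAntichain X → Consistent φ X a)

-- Encode the tree by the comb whose i-th tooth is the branch 1ⁱ0 followed by
-- zeros: put b i j = a (1ⁱ 0 0ʲ). Nodes on one tooth form a chain, so any two
-- distinct ones are comparable and their instances are inconsistent; nodes on
-- different teeth split at the shorter prefix of ones, so a choice of one node
-- per tooth is an antichain and the corresponding instances are consistent.
module Submission where

open import Defs
open import Data.Bool using (true; false)
open import Data.List using ([]; _∷_; _++_; replicate; map; length)
open import Data.List.Properties using (++-assoc; ∷-injectiveʳ; length-replicate)
open import Data.List.Relation.Unary.All as All using (All)
open import Data.List.Relation.Unary.All.Properties using (map⁻)
open import Data.Nat using (ℕ; zero; suc; pred; _+_; _∸_; _≤_)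
open import Data.Nat.Properties using (≤-total; m+[n∸m]≡n)
open import Data.Product using (Σ; ∃; _×_; _,_; proj₁; proj₂)
open import Data.Sum using (_⊎_; inj₁; inj₂)
open import Function using (_∘_)
open import Relation.Binary.PropositionalEquality using (_≡_; _≢_; refl; sym; trans; cong; module ≡-Reasoning)
open import Relation.Nullary using (¬_)

module _ {A B : Set} (φ : A → B → Set) where

  realised⇒consistent : ∀ {I} {S : I → Set} {b : I → B} (x : A) →
    (∀ {i} → S i → φ x (b i)) → Consistent φ S b
  realised⇒consistent x sat l Sl = x , All.map sat Sl

  consistent-image⇒consistent : ∀ {I J} (b : J → B) (g : I → J) →
    Consistent φ (λ j → ∃ λ i → j ≡ g i) b → Consistent φ Everything (b ∘ g)
  consistent-image⇒consistent b g con l _ =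
    let x , sat = con (map g l) (image l) in x , map⁻ sat
    where
    image : ∀ l → All (λ j → ∃ λ i → j ≡ g i) (map g l)
    image []      = All.[]
    image (i ∷ l) = (i , refl) All.∷ image l

  module _ {a : Tree → B} (tree : IsAntichainTree φ a) where

    comparable-inconsistent : ∀ {η ν} → η ⊴ ν → η ≢ ν →
      ¬ (Σ A λ x → φ x (a η) × φ x (a ν))
    comparable-inconsistent {η} {ν} η⊴ν η≢ν (x , φη , φν) =
      η≢ν (proj₁ (tree Pair) consistent η ν (inj₁ refl) (inj₂ refl) η⊴ν)
      where
      Pair : Tree → Set
      Pair ζ = ζ ≡ η ⊎ ζ ≡ ν
      consistent : Consistent φ Pair a
      consistent = realised⇒consistent x λ { (inj₁ refl) → φη ; (inj₂ refl) → φν }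

    antichain-consistent : ∀ {X} → IsAntichain X → Consistent φ X a
    antichain-consistent = proj₂ (tree _)

replicate-++ : ∀ {A : Set} m n (x : A) →
  replicate m x ++ replicate n x ≡ replicate (m + n) x
replicate-++ zero    n x = refl
replicate-++ (suc m) n x = cong (x ∷_) (replicate-++ m n x)

tooth : ℕ → ℕ → Tree
tooth i j = replicate i true ++ replicate (suc j) false

tooth-++-falses : ∀ i j k → tooth i j ++ replicate k false ≡ tooth i (j + k)
tooth-++-falses i j k = begin
  (replicate i true ++ replicate (suc j) false) ++ replicate k false
    ≡⟨ ++-assoc (replicate i true) _ _ ⟩
  replicate i true ++ (replicate (suc j) false ++ replicate k false)
    ≡⟨ cong (replicate i true ++_) (replicate-++ (suc j) k false) ⟩
  tooth i (j + k) ∎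
  where open ≡-Reasoning

tooth-⊴ : ∀ i {j j′} → j ≤ j′ → tooth i j ⊴ tooth i j′
tooth-⊴ i {j} {j′} j≤j′ =
  replicate (j′ ∸ j) false ,
  trans (tooth-++-falses i j (j′ ∸ j)) (cong (tooth i) (m+[n∸m]≡n j≤j′))

tooth-comparable : ∀ i j j′ → tooth i j ⊴ tooth i j′ ⊎ tooth i j′ ⊴ tooth i j
tooth-comparable i j j′ with ≤-total j j′
... | inj₁ j≤j′ = inj₁ (tooth-⊴ i j≤j′)
... | inj₂ j′≤j = inj₂ (tooth-⊴ i j′≤j)

tooth-injectiveʳ : ∀ i {j j′} → tooth i j ≡ tooth i j′ → j ≡ j′
tooth-injectiveʳ zero {j} {j′} eq = cong pred (begin
  suc j                               ≡⟨ sym (length-replicate (suc j)) ⟩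
  length (replicate (suc j) false)    ≡⟨ cong length eq ⟩
  length (replicate (suc j′) false)   ≡⟨ length-replicate (suc j′) ⟩
  suc j′                              ∎)
  where open ≡-Reasoning
tooth-injectiveʳ (suc i) eq = tooth-injectiveʳ i (∷-injectiveʳ eq)

tooth-⊴⇒same-tooth : ∀ {i i′ j j′} → tooth i j ⊴ tooth i′ j′ → i ≡ i′
tooth-⊴⇒same-tooth {zero}  {zero}   _       = refl
tooth-⊴⇒same-tooth {zero}  {suc _}  (_ , ())
tooth-⊴⇒same-tooth {suc _} {zero}   (_ , ())
tooth-⊴⇒same-tooth {suc i} {suc i′} (ρ , eq) =
  cong suc (tooth-⊴⇒same-tooth {i} {i′} (ρ , ∷-injectiveʳ eq))

transversal-antichain : (f : ℕ → ℕ) → IsAntichain (λ η → ∃ λ i → η ≡ tooth i (f i))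
transversal-antichain f _ _ (i , refl) (i′ , refl) i⊴i′ with tooth-⊴⇒same-tooth {i} {i′} i⊴i′
... | refl = refl

proposition4p6 : {A B : Set} (φ : A → B → Set) (a : Tree → B) →
    IsAntichainTree φ a → HasTP2 φ
proposition4p6 φ a tree = b , tooth-2-inconsistent , transversal-consistent
  where
  b : ℕ → ℕ → _
  b i j = a (tooth i j)

  tooth-2-inconsistent : ∀ i → TwoInconsistent φ (b i)
  tooth-2-inconsistent i j j′ j≢j′ with tooth-comparable i j j′
  ... | inj₁ j⊴j′ = comparable-inconsistent φ tree j⊴j′ (j≢j′ ∘ tooth-injectiveʳ i)
  ... | inj₂ j′⊴j = comparable-inconsistent φ tree j′⊴j (j≢j′ ∘ sym ∘ tooth-injectiveʳ i)
                    ∘ λ (x , φj , φj′) → x , φj′ , φj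

  transversal-consistent : ∀ f → Consistent φ Everything (λ i → b i (f i))
  transversal-consistent f =
    consistent-image⇒consistent φ a (λ i → tooth i (f i))
      (antichain-consistent φ tree (transversal-antichain f))
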